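{- Fix a natural number $b>1$. Let $D,\Delta,\beta,N_1,N_2,p\in\mathbb N$ with $\Delta\ge 2$. The number of isomorphism classes of grounded decorated landscapes of type $(D,\Delta,\beta,N_1,N_2,p)$ is at most $$C\cdot N_2^{N_1}\cdot\left(\frac{\Delta^\Delta}{(\Delta-1)^{\Delta-1}}\cdot\beta\right)^{N_2},$$ where $C$ depends only on $(D,\Delta,N_1,p)$ (and the fixed $b$).
   Context: $b$ is identified with $\{0,\dots,b-1\}$; $A^B$ is the set of functions $B\to A$. A variable graph is an oriented graph $G$ (edge set $E\subseteq V\times V$, self-loops allowed) together with a well-order on $\operatorname{Var}(x)=\{y:(x,y)\in E\}$ and on $\operatorname{Cl}(x)=\{y:(y,x)\in E\}$ for each $x$. $\operatorname{Rel}(G)$ is the oriented graph on $V(G)$ with edge $x\to y$ iff $\operatorname{Var}(x)\cap\operatorname{Var}(y)\neq\emptyset$; its out-edges at $x$ are labelled by distinct natural numbers $0,1,\dots$ according to the following order on the out-neighbours: for distinct $y,z$, let $v,w$ be the least elements of $\operatorname{Var}(x)\cap\operatorname{Var}(y)$ and $\operatorname{Var}(x)\cap\operatorname{Var}(z)$ in $\operatorname{Var}(x)$; $y<z$ iff $v<w$, or $v=w$ and $y<z$ in $\operatorname{Cl}(v)$. $\operatorname{Canvas}(G)$ has vertex set $V(G)\times\mathbb N$ and, for every edge $(x,y)$ of $\operatorname{Rel}(G)$ and $i\in\mathbb N$, an edge $((x,i),(y,i+1))$ carrying the label of $(x,y)$. For $x=(\bar x,i)$, $\ell(x)=i$ is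 its level. A landscape $\mathcal L$ consists of a variable graph $G_{\mathcal L}$, a local rule $\mathbf R_{\mathcal L}$ (a set $\mathbf R_{\mathcal L}(x)\subseteq b^{\operatorname{Var}(x)}$ for each $x$; $\mathbf R^c_{\mathcal L}(x)$ its complement in $b^{\operatorname{Var}(x)}$), and a subgraph $\operatorname{For}(\mathcal L)$ of $\operatorname{Canvas}(G_{\mathcal L})$ (vertex set $V(\mathcal L)$) in which every vertex has in-degree $0$ or $1$, such that for every $i$ and distinct $x,y\in V(\mathcal L)$ of level $i$, $\bar x$ and $\bar y$ are at distance at least $2$ in $\operatorname{Rel}(G_{\mathcal L})$. It is grounded if every connected component (tree) of $\operatorname{For}(\mathcal L)$ has its minimal-level vertex at level $0$. It is of type $(D,\Delta,\beta)$ if the maximal out-degree in $G_{\mathcal L}$ is $\le D$, the maximal degree in $\operatorname{Rel}(G_{\mathcal L})$ is $\le\Delta$, and $|\mathbf R^c_{\mathcal L}(x)|\le\beta$ for all $x$. A decoration consists of a function $\mathrm{Final}\in b^{V(G_{\mathcal L})}$, for each $x\in V(\mathcal L)$ an element $\mathrm{Prev}(x)\in\mathbf R^c_{\mathcal L}(\bar x)$, and a function $\pi\colon V(G_{\mathcal L})\to\mathbb N$. A decorated landscape is of type $(D,\Delta,\beta,N_1,N_2,p)$ if it is of type $(D,\Delta,\beta)$, $|V(G_{\mathcal L})|\le N_1$, $|V(\mathcal L)|=N_2$ and $\pi$ takes values in $\{0,\dots,p-1\}$. An isomorphism of decorated landscapes is a bijection $V(G_{\mathcal K})\to V(G_{\mathcal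 L})$ inducing an isomorphism of the oriented graphs compatible with the orders on all $\operatorname{Var}(x)$, $\operatorname{Cl}(x)$ and with the local rules, inducing (via $(\bar x,i)\mapsto(\phi(\bar x),i)$) an isomorphism of the forests, and compatible with the decorations. -}

module Defs where

open import Data.Nat using (ℕ; zero; suc; _≤_; _<_)
open import Data.Fin using (Fin)
import Data.Fin.Properties as FinP
open import Data.List using (List; length; map; filter; allFin)
open import Data.List.Relation.Unary.Any as Any using (Any)
open import Data.List.Relation.Unary.Unique.Propositional using (Unique)
open import Data.List.Membership.Propositional using (_∈_)
open import Data.List.Membership.DecPropositional as DecMem using ()
open import Data.Product using (Σ; ∃; _×_; _,_; proj₁; proj₂)
open import Function.Bundles using (_↔_; Inverse)
open import Relation.Binary.PropositionalEquality using (_≡_; _≢_)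
open import Relation.Binary.Construct.Closure.ReflexiveTransitive using (Star)
open import Relation.Nullary using (¬_; Dec)
open import Data.Sum using (_⊎_)

-- Var(x) is given as a duplicate-free list; the well-order on Var(x) is
-- the order of the list.  Likewise for Cl(x).  The edge set is
-- E = {(x,y) : y ∈ var x}, and Cl must be its transpose.

record VarGraph (n : ℕ) : Set where
  field
    var        : Fin n → List (Fin n)
    cl         : Fin n → List (Fin n)
    var-unique : ∀ x → Unique (var x)
    cl-unique  : ∀ x → Unique (cl x)
    var⇒cl     : ∀ x y → y ∈ var x → x ∈ cl y
    cl⇒var     : ∀ x y → x ∈ cl y → y ∈ var x
open VarGraph public

RelEdge : ∀ {n} → VarGraph n → Fin n → Fin n → Set
RelEdge G x y = Any (λ z → z ∈ var G y) (var G x)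

relEdge? : ∀ {n} (G : VarGraph n) (x y : Fin n) → Dec (RelEdge G x y)
relEdge? G x y = Any.any? (λ z → DecMem._∈?_ FinP._≟_ z (var G y)) (var G x)

relDeg : ∀ {n} → VarGraph n → Fin n → ℕ
relDeg {n} G x = length (filter (relEdge? G x) (allFin n))

-- distance at least 2 in Rel(G) (for a symmetric graph: distinct and
-- not adjacent)
Dist≥2 : ∀ {n} → VarGraph n → Fin n → Fin n → Set
Dist≥2 G x y = x ≢ y × ¬ RelEdge G x y

CVert : ℕ → Set
CVert n = Fin n × ℕ

level : ∀ {n} → CVert n → ℕ
level = proj₂

CanvasEdge : ∀ {n} → VarGraph n → CVert n → CVert n → Set
CanvasEdge G (x , i) (y , j) = RelEdge G x y × j ≡ suc i

-- An assignment in b^{Var(x)} is encoded as the list of its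
-- values along the order of Var(x).  The local rule is given through its
-- complement R^c(x) (a duplicate-free list of such assignments).

record Landscape (b n : ℕ) : Set where
  field
    graph        : VarGraph n
    rc           : Fin n → List (List (Fin b))
    rc-valid     : ∀ x a → a ∈ rc x → length a ≡ length (var graph x)
    rc-unique    : ∀ x → Unique (rc x)
    verts        : List (CVert n)
    verts-unique : Unique verts
    edges        : List (CVert n × CVert n)
    edges-src    : ∀ {v w} → (v , w) ∈ edges → v ∈ verts
    edges-tgt    : ∀ {v w} → (v , w) ∈ edges → w ∈ verts
    edges-canvas : ∀ {v w} → (v , w) ∈ edges → CanvasEdge graph v w
    indeg≤1      : ∀ {v v' w} → (v , w) ∈ edges → (v' , w) ∈ edges → v ≡ v'
    separated    : ∀ {v w} → v ∈ verts → w ∈ verts → v ≢ w →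
                   level v ≡ level w → Dist≥2 graph (proj₁ v) (proj₁ w)
open Landscape public

Adj : ∀ {b n} → Landscape b n → CVert n → CVert n → Set
Adj L v w = ((v , w) ∈ edges L) ⊎ ((w , v) ∈ edges L)

-- grounded: every component's minimal level is 0, i.e. every component
-- contains a vertex of level 0
Grounded : ∀ {b n} → Landscape b n → Set
Grounded L = ∀ {v} → v ∈ verts L → ∃ λ u → Star (Adj L) v u × level u ≡ 0

record Decoration {b n : ℕ} (L : Landscape b n) : Set where
  field
    final   : Fin n → Fin b
    prev    : CVert n → List (Fin b)
    prev-ok : ∀ {v} → v ∈ verts L → prev v ∈ rc L (proj₁ v)
    π       : Fin n → ℕ
open Decoration public

record DLand (b n : ℕ) : Set where
  field
    land : Landscape b n
    deco : Decoration land
open DLand public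

record HasType {b n : ℕ} (D Δ β N₁ N₂ p : ℕ) (K : DLand b n) : Set where
  field
    size   : n ≤ N₁
    outdeg : ∀ x → length (var (graph (land K)) x) ≤ D
    reldeg : ∀ x → relDeg (graph (land K)) x ≤ Δ
    rcsize : ∀ x → length (rc (land K) x) ≤ β
    nverts : length (verts (land K)) ≡ N₂
    πbound : ∀ x → π (deco K) x < p

mapV : ∀ {n m} → (Fin n → Fin m) → CVert n → CVert m
mapV f (x , i) = (f x , i)

mapE : ∀ {n m} → (Fin n → Fin m) → CVert n × CVert n → CVert m × CVert m
mapE f (v , w) = (mapV f v , mapV f w)

record Iso {b n m : ℕ} (K : DLand b n) (K' : DLand b m) : Set where
  private
    L  = land K
    L' = land K'
    G  = graph L
    G' = graph L'
  field
    φ       : Fin n ↔ Fin m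
  private
    f = Inverse.to φ
  field
    var-hom   : ∀ x → var G' (f x) ≡ map f (var G x)
    cl-hom    : ∀ x → cl G' (f x) ≡ map f (cl G x)
    rule-to   : ∀ x a → a ∈ rc L x → a ∈ rc L' (f x)
    rule-from : ∀ x a → a ∈ rc L' (f x) → a ∈ rc L x
    verts-to   : ∀ v → v ∈ verts L → mapV f v ∈ verts L'
    verts-from : ∀ v → mapV f v ∈ verts L' → v ∈ verts L
    edges-to   : ∀ e → e ∈ edges L → mapE f e ∈ edges L'
    edges-from : ∀ e → mapE f e ∈ edges L' → e ∈ edges L
    final-hom : ∀ x → final (deco K') (f x) ≡ final (deco K) x
    prev-hom  : ∀ v → v ∈ verts L → prev (deco K') (mapV f v) ≡ prev (deco K) v
    π-hom     : ∀ x → π (deco K') (f x) ≡ π (deco K) x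

-- A grounded decorated landscape is determined up to isomorphism by three pieces of data. First its variable
-- graph, R^c, Final, π and the level-0 layer of its forest: finitely many choices, depending only on b, D,
-- N₁ and p. Second its forest: since every tree meets level 0 and in-degrees are at most 1, the forest is
-- recovered layer by layer from the level-0 layer once each of the N₂ vertices records which of its at
-- most Δ neighbours in Rel(G) carry its children, a bit string of length ΔN₂ with at most N₂ ones.
-- Third, for each forest vertex, the position of Prev in the list R^c of its variable, a number below β.
-- Weighting each bit string by (Δ-1)^(number of zeros), the binomial theorem bounds the number of those
-- bit strings by Δ^(ΔN₂) / (Δ-1)^((Δ-1)N₂).

module Submission where

open import Defs
open import Data.Bool using (Bool; true; false)
open import Data.Empty using (⊥-elim)
open import Data.Fin using (Fin)
import Data.Fin as Fin
import Data.Fin.Properties as FinP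
open import Data.List
  using ( List; []; _∷_; _++_; [_]; length; map; filter; replicate; take; drop; concat; allFin; upTo
        ; deduplicate; cartesianProduct)
import Data.List.Properties as List
import Data.List.Relation.Unary.Any as Any
open import Data.List.Membership.Propositional using (_∈_; find; lose)
open import Data.List.Membership.Propositional.Properties
  using ( ∈-∃++; ∈-++⁻; ∈-++⁺ˡ; ∈-++⁺ʳ; ∈-map⁺; ∈-map⁻; ∈-filter⁺; ∈-filter⁻; ∈-concat⁺′; ∈-cartesianProduct⁺
        ; ∈-allFin; ∈-upTo⁺; ∈-deduplicate⁺; ∈-deduplicate⁻)
open import Data.List.Relation.Binary.Subset.Propositional using (_⊆_)
open import Data.List.Relation.Unary.All as All using (All; []; _∷_)
import Data.List.Relation.Unary.All.Properties as All
open import Data.List.Relation.Unary.Any using (Any; here; there)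
open import Data.List.Relation.Unary.Unique.Propositional using (Unique; []; _∷_)
import Data.List.Relation.Unary.Unique.Propositional.Properties as Unique
import Data.List.Relation.Unary.Unique.DecPropositional as DecUnique
import Data.List.Relation.Unary.Unique.DecPropositional.Properties as DecUnique
import Data.List.Membership.DecPropositional as DecMembership
open import Data.Nat using (ℕ; zero; suc; _+_; _*_; _^_; _∸_; _≤_; _<_; z≤n; s≤s; _≤?_; _≟_; >-nonZero)
open import Data.Nat.Properties
open import Algebra.Properties.CommutativeSemigroup *-commutativeSemigroup using (interchange)
open import Data.Nat.ListAction using (sum)
open import Data.Nat.ListAction.Properties using (sum-++)
open import Data.Product using (Σ; ∃; _×_; _,_; proj₁; proj₂)
import Data.Product.Properties as Product
open import Data.Sum using (inj₁; inj₂)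
open import Function.Construct.Identity using (↔-id)
open import Data.Vec using (Vec; lookup; tabulate; toList; fromList)
  renaming ([] to []ᵥ; _∷_ to _∷ᵥ_)
import Data.Vec.Properties as Vec
open import Relation.Binary.Construct.Closure.ReflexiveTransitive using (Star; ε; _◅_)
open import Relation.Binary.Definitions using (DecidableEquality)
open import Relation.Binary.PropositionalEquality hiding ([_])
open import Relation.Nullary using (¬_; Dec; yes; no; ¬?)
open import Relation.Nullary.Decidable using (⌊_⌋; _×-dec_; _→-dec_)

module _ {A : Set} where

  private
    ∈-delete : ∀ {z x : A} us vs → z ∈ us ++ x ∷ vs → z ≢ x → z ∈ us ++ vs
    ∈-delete []       vs (here z≡x) z≢x = ⊥-elim (z≢x z≡x)
    ∈-delete []       vs (there z∈)  _  = z∈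
    ∈-delete (u ∷ us) vs (here z≡u) _   = here z≡u
    ∈-delete (u ∷ us) vs (there z∈) z≢x = there (∈-delete us vs z∈ z≢x)

    length-++-∷ : ∀ us (x : A) vs → length (us ++ x ∷ vs) ≡ suc (length (us ++ vs))
    length-++-∷ []       x vs = refl
    length-++-∷ (u ∷ us) x vs = cong suc (length-++-∷ us x vs)

  Unique-⊆⇒length≤ : ∀ {xs ys : List A} → Unique xs → xs ⊆ ys → length xs ≤ length ys
  Unique-⊆⇒length≤ {[]}     _          _  = z≤n
  Unique-⊆⇒length≤ {x ∷ xs} (x∉ ∷ !xs) xs⊆ys with ∈-∃++ (xs⊆ys (here refl))
  ... | us , vs , refl = subst (suc (length xs) ≤_) (sym (length-++-∷ us x vs))
    (s≤s (Unique-⊆⇒length≤ !xs λ z∈xs →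
      ∈-delete us vs (xs⊆ys (there z∈xs)) (λ z≡x → All.lookup x∉ z∈xs (sym z≡x))))

  length-filter*≤sum : ∀ {P : A → Set} (P? : ∀ x → Dec (P x)) c (w : A → ℕ) xs →
    (∀ {x} → x ∈ xs → P x → c ≤ w x) → length (filter P? xs) * c ≤ sum (map w xs)
  length-filter*≤sum P? c w []       _ = z≤n
  length-filter*≤sum P? c w (x ∷ xs) h with P? x
  ... | yes px = +-mono-≤ (h (here refl) px) (length-filter*≤sum P? c w xs (λ m → h (there m)))
  ... | no  _  = ≤-trans (length-filter*≤sum P? c w xs (λ m → h (there m))) (m≤n+m _ (w x))

bitStrings : ℕ → List (List Bool)
bitStrings zero    = [ [] ]
bitStrings (suc m) = map (true ∷_) (bitStrings m) ++ map (false ∷_) (bitStrings m)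

trues falses : List Bool → ℕ
trues []           = 0
trues (true  ∷ s)  = suc (trues s)
trues (false ∷ s)  = trues s
falses []          = 0
falses (true  ∷ s) = falses s
falses (false ∷ s) = suc (falses s)

sparseBitStrings : ℕ → ℕ → List (List Bool)
sparseBitStrings m k = filter (λ s → trues s ≤? k) (bitStrings m)

∈-bitStrings : ∀ s → s ∈ bitStrings (length s)
∈-bitStrings []          = here refl
∈-bitStrings (true  ∷ s) = ∈-++⁺ˡ (∈-map⁺ (true ∷_) (∈-bitStrings s))
∈-bitStrings (false ∷ s) = ∈-++⁺ʳ _ (∈-map⁺ (false ∷_) (∈-bitStrings s))

∈-sparseBitStrings : ∀ {m k} s → length s ≡ m → trues s ≤ k → s ∈ sparseBitStrings m k
∈-sparseBitStrings {k = k} s refl = ∈-filter⁺ (λ s → trues s ≤? k) (∈-bitStrings s)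

trues+falses : ∀ m {s} → s ∈ bitStrings m → trues s + falses s ≡ m
trues+falses zero    (here refl) = refl
trues+falses (suc m) s∈ with ∈-++⁻ (map (true ∷_) (bitStrings m)) s∈
... | inj₁ s∈ₜ with t , t∈ , refl ← ∈-map⁻ (true ∷_) s∈ₜ = cong suc (trues+falses m t∈)
... | inj₂ s∈f with t , t∈ , refl ← ∈-map⁻ (false ∷_) s∈f =
  trans (+-suc (trues t) (falses t)) (cong suc (trues+falses m t∈))

trues-++ : ∀ s t → trues (s ++ t) ≡ trues s + trues t
trues-++ []          t = refl
trues-++ (true  ∷ s) t = cong suc (trues-++ s t)
trues-++ (false ∷ s) t = trues-++ s t

trues-replicate-false : ∀ k → trues (replicate k false) ≡ 0
trues-replicate-false zero    = refl
trues-replicate-false (suc k) = trues-replicate-false k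

sum-^falses : ∀ a m → sum (map (λ s → a ^ falses s) (bitStrings m)) ≡ suc a ^ m
sum-^falses a zero    = refl
sum-^falses a (suc m) = begin
  sum (map w (map (true ∷_) ss ++ map (false ∷_) ss))
    ≡⟨ cong sum (List.map-++ w (map (true ∷_) ss) _) ⟩
  sum (map w (map (true ∷_) ss) ++ map w (map (false ∷_) ss))
    ≡⟨ sum-++ (map w (map (true ∷_) ss)) _ ⟩
  sum (map w (map (true ∷_) ss)) + sum (map w (map (false ∷_) ss))
    ≡⟨ cong₂ _+_ (cong sum (sym (List.map-∘ ss))) (cong sum (sym (List.map-∘ ss))) ⟩
  sum (map w ss) + sum (map (λ s → a * w s) ss)
    ≡⟨ cong (sum (map w ss) +_) (sum-map-* ss) ⟩
  sum (map w ss) + a * sum (map w ss)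
    ≡⟨ cong (λ t → t + a * t) (sum-^falses a m) ⟩
  suc a ^ m + a * suc a ^ m
    ∎
  where
  open ≡-Reasoning
  ss = bitStrings m
  w : List Bool → ℕ
  w s = a ^ falses s
  sum-map-* : ∀ xs → sum (map (λ s → a * w s) xs) ≡ a * sum (map w xs)
  sum-map-* []       = sym (*-zeroʳ a)
  sum-map-* (s ∷ xs) = trans (cong (a * w s +_) (sum-map-* xs)) (sym (*-distribˡ-+ a (w s) _))

-- Weighting s by (1 + a) ^ falses s, each string with at most k ones weighs at least (1 + a) ^ (m ∸ k).
length-sparseBitStrings* : ∀ a m k → length (sparseBitStrings m k) * suc a ^ (m ∸ k) ≤ suc (suc a) ^ m
length-sparseBitStrings* a m k = ≤-trans
  (length-filter*≤sum (λ s → trues s ≤? k) (suc a ^ (m ∸ k)) (λ s → suc a ^ falses s) (bitStrings m)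
     (λ {s} s∈ ≤k → ^-monoʳ-≤ (suc a) (m∸k≤falses s∈ ≤k)))
  (≤-reflexive (sum-^falses (suc a) m))
  where
  m∸k≤falses : ∀ {s} → s ∈ bitStrings m → trues s ≤ k → m ∸ k ≤ falses s
  m∸k≤falses {s} s∈ ≤k = begin
    m ∸ k                          ≤⟨ ∸-monoʳ-≤ m ≤k ⟩
    m ∸ trues s                    ≡⟨ cong (_∸ trues s) (sym (trues+falses m s∈)) ⟩
    trues s + falses s ∸ trues s   ≡⟨ m+n∸m≡n (trues s) (falses s) ⟩
    falses s                       ∎
    where open ≤-Reasoning

module _ {A B : Set} where

  length-cartesianProduct : (xs : List A) (ys : List B) →
    length (cartesianProduct xs ys) ≡ length xs * length ys
  length-cartesianProduct []       ys = refl
  length-cartesianProduct (x ∷ xs) ys = begin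
    length (map (x ,_) ys ++ cartesianProduct xs ys)           ≡⟨ List.length-++ (map (x ,_) ys) ⟩
    length (map (x ,_) ys) + length (cartesianProduct xs ys)   ≡⟨ cong₂ _+_ (List.length-map (x ,_) ys)
                                                                   (length-cartesianProduct xs ys) ⟩
    length ys + length xs * length ys                          ∎
    where open ≡-Reasoning

module _ {A : Set} where

  vectors : List A → (n : ℕ) → List (Vec A n)
  vectors as zero    = [ []ᵥ ]
  vectors as (suc n) = map (λ (a , v) → a ∷ᵥ v) (cartesianProduct as (vectors as n))

  length-vectors : ∀ as n → length (vectors as n) ≡ length as ^ n
  length-vectors as zero    = refl
  length-vectors as (suc n) = begin
    length (map _ (cartesianProduct as (vectors as n)))  ≡⟨ List.length-map _ (cartesianProduct as (vectors as n)) ⟩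
    length (cartesianProduct as (vectors as n))          ≡⟨ length-cartesianProduct as (vectors as n) ⟩
    length as * length (vectors as n)                    ≡⟨ cong (length as *_) (length-vectors as n) ⟩
    length as * length as ^ n                            ∎
    where open ≡-Reasoning

  ∈-vectors : ∀ {as n} (v : Vec A n) → (∀ i → lookup v i ∈ as) → v ∈ vectors as n
  ∈-vectors []ᵥ       _ = here refl
  ∈-vectors (a ∷ᵥ v) h = ∈-map⁺ (λ (a , v) → a ∷ᵥ v)
    (∈-cartesianProduct⁺ (h Fin.zero) (∈-vectors v (λ i → h (Fin.suc i))))

  tabulate∈vectors : ∀ {as n} (f : Fin n → A) → (∀ i → f i ∈ as) → tabulate f ∈ vectors as n
  tabulate∈vectors {as} f h = ∈-vectors (tabulate f) (λ i → subst (_∈ as) (sym (Vec.lookup∘tabulate f i)) (h i))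

  listsOfLength : List A → ℕ → List (List A)
  listsOfLength as n = map toList (vectors as n)

  length-listsOfLength : ∀ as n → length (listsOfLength as n) ≡ length as ^ n
  length-listsOfLength as n = trans (List.length-map toList (vectors as n)) (length-vectors as n)

  ∈-listsOfLength : ∀ {as n} xs → All (_∈ as) xs → length xs ≡ n → xs ∈ listsOfLength as n
  ∈-listsOfLength {as} xs xs⊆as refl = subst (_∈ listsOfLength as (length xs)) (Vec.toList∘fromList xs)
    (∈-map⁺ toList (∈-vectors (fromList xs) (lookup-fromList xs xs⊆as)))
    where
    lookup-fromList : ∀ ys → All (_∈ as) ys → ∀ i → lookup (fromList ys) i ∈ as
    lookup-fromList (y ∷ ys) (y∈ ∷ _)   Fin.zero    = y∈
    lookup-fromList (y ∷ ys) (_ ∷ ys⊆) (Fin.suc i) = lookup-fromList ys ys⊆ i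

  listsUpTo : List A → ℕ → List (List A)
  listsUpTo as zero    = [ [] ]
  listsUpTo as (suc k) = [] ∷ map (λ (a , xs) → a ∷ xs) (cartesianProduct as (listsUpTo as k))

  ∈-listsUpTo : ∀ {as k} xs → All (_∈ as) xs → length xs ≤ k → xs ∈ listsUpTo as k
  ∈-listsUpTo {k = zero}  []       _          _       = here refl
  ∈-listsUpTo {k = suc k} []       _          _       = here refl
  ∈-listsUpTo {k = suc k} (x ∷ xs) (x∈ ∷ xs⊆) (s≤s ≤k) =
    there (∈-map⁺ (λ (a , xs) → a ∷ xs) (∈-cartesianProduct⁺ x∈ (∈-listsUpTo xs xs⊆ ≤k)))

  sublists : List A → List (List A)
  sublists []       = [ [] ]
  sublists (x ∷ xs) = map (x ∷_) (sublists xs) ++ sublists xs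

  filter∈sublists : ∀ {P : A → Set} (P? : ∀ x → Dec (P x)) xs → filter P? xs ∈ sublists xs
  filter∈sublists P? []       = here refl
  filter∈sublists P? (x ∷ xs) with P? x
  ... | yes _ = ∈-++⁺ˡ (∈-map⁺ (x ∷_) (filter∈sublists P? xs))
  ... | no  _ = ∈-++⁺ʳ _ (filter∈sublists P? xs)

module _ {A : Set} where

  lookupOr : A → List A → ℕ → A
  lookupOr d []       _       = d
  lookupOr d (x ∷ xs) zero    = x
  lookupOr d (x ∷ xs) (suc k) = lookupOr d xs k

  select : List A → List Bool → List A
  select (x ∷ xs) (true  ∷ bs) = x ∷ select xs bs
  select (x ∷ xs) (false ∷ bs) = select xs bs
  select _        _            = []

  select-mask : ∀ {P : A → Set} (P? : ∀ x → Dec (P x)) xs junk →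
    select xs (map (λ x → ⌊ P? x ⌋) xs ++ junk) ≡ filter P? xs
  select-mask P? []       []      = refl
  select-mask P? []       (_ ∷ _) = refl
  select-mask P? (x ∷ xs) junk with P? x
  ... | yes _ = cong (x ∷_) (select-mask P? xs junk)
  ... | no  _ = select-mask P? xs junk

  trues-mask : ∀ {P : A → Set} (P? : ∀ x → Dec (P x)) xs →
    trues (map (λ x → ⌊ P? x ⌋) xs) ≡ length (filter P? xs)
  trues-mask P? []       = refl
  trues-mask P? (x ∷ xs) with P? x
  ... | yes _ = cong suc (trues-mask P? xs)
  ... | no  _ = trues-mask P? xs

  take-length-++ : ∀ (xs ys : List A) → take (length xs) (xs ++ ys) ≡ xs
  take-length-++ []       ys = refl
  take-length-++ (x ∷ xs) ys = cong (x ∷_) (take-length-++ xs ys)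

  drop-length-++ : ∀ (xs ys : List A) → drop (length xs) (xs ++ ys) ≡ ys
  drop-length-++ []       ys = refl
  drop-length-++ (x ∷ xs) ys = drop-length-++ xs ys

  module _ (_≟_ : DecidableEquality A) where

    indexOf : A → List A → ℕ
    indexOf a []       = 0
    indexOf a (x ∷ xs) with a ≟ x
    ... | yes _ = 0
    ... | no  _ = suc (indexOf a xs)

    indexOf< : ∀ {a} xs → a ∈ xs → indexOf a xs < length xs
    indexOf< {a} (x ∷ xs) a∈ with a ≟ x | a∈
    ... | yes _   | _          = s≤s z≤n
    ... | no  a≢x | here a≡x   = ⊥-elim (a≢x a≡x)
    ... | no  _   | there a∈xs = s≤s (indexOf< xs a∈xs)

    lookupOr-indexOf : ∀ {a} d xs → a ∈ xs → lookupOr d xs (indexOf a xs) ≡ a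
    lookupOr-indexOf {a} d (x ∷ xs) a∈ with a ≟ x | a∈
    ... | yes a≡x | _          = sym a≡x
    ... | no  a≢x | here a≡x   = ⊥-elim (a≢x a≡x)
    ... | no  _   | there a∈xs = lookupOr-indexOf d xs a∈xs

    valueAt : A → List A → List ℕ → ℕ
    valueAt a []       _        = 0
    valueAt a (_ ∷ _)  []       = 0
    valueAt a (x ∷ xs) (k ∷ ks) with a ≟ x
    ... | yes _ = k
    ... | no  _ = valueAt a xs ks

    valueAt-map : ∀ {a} xs (g : A → ℕ) → a ∈ xs → valueAt a xs (map g xs) ≡ g a
    valueAt-map {a} (x ∷ xs) g a∈ with a ≟ x | a∈
    ... | yes a≡x | _          = cong g (sym a≡x)
    ... | no  a≢x | here a≡x   = ⊥-elim (a≢x a≡x)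
    ... | no  _   | there a∈xs = valueAt-map xs g a∈xs

edge : ∀ {n} → Fin n → ℕ → Fin n → CVert n × CVert n
edge x i y = (x , i) , (y , suc i)

-- A forest all of whose roots lie in the layer S at level i is coded by one block of Δ bits per vertex,
-- marking which of its (at most Δ) neighbours carry its children.
module ForestCode {n : ℕ} (nb : Fin n → List (Fin n)) (Δ : ℕ) where

  decodeLayer : ℕ → List (Fin n) → List Bool → List (Fin n) × List (CVert n × CVert n) × List Bool
  decodeLayer i []       bs = [] , [] , bs
  decodeLayer i (x ∷ xs) bs =
    let cs = select (nb x) (take Δ bs)
        (ys , es , rest) = decodeLayer i xs (drop Δ bs)
    in cs ++ ys , map (edge x i) cs ++ es , rest

  decodeForest : ℕ → ℕ → List (Fin n) → List Bool → List (CVert n) × List (CVert n × CVert n)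
  decodeForest zero    i S bs = [] , []
  decodeForest (suc f) i S bs =
    let (T , es , rest) = decodeLayer i S bs
        (vs , es′)      = decodeForest f (suc i) T rest
    in map (_, i) S ++ vs , es ++ es′

  module Encode (P : CVert n → Fin n → Set) (P? : ∀ v y → Dec (P v y)) where

    children : Fin n → ℕ → List (Fin n)
    children x i = filter (P? (x , i)) (nb x)

    mask : Fin n → ℕ → List Bool
    mask x i = map (λ y → ⌊ P? (x , i) y ⌋) (nb x)

    childCode : Fin n → ℕ → List Bool
    childCode x i = mask x i ++ replicate (Δ ∸ length (mask x i)) false

    nextLayer : ℕ → List (Fin n) → List (Fin n)
    nextLayer i []       = []
    nextLayer i (x ∷ xs) = children x i ++ nextLayer i xs

    layerEdges : ℕ → List (Fin n) → List (CVert n × CVert n)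
    layerEdges i []       = []
    layerEdges i (x ∷ xs) = map (edge x i) (children x i) ++ layerEdges i xs

    layerCode : ℕ → List (Fin n) → List Bool
    layerCode i []       = []
    layerCode i (x ∷ xs) = childCode x i ++ layerCode i xs

    forestVerts : ℕ → ℕ → List (Fin n) → List (CVert n)
    forestVerts zero    i S = []
    forestVerts (suc f) i S = map (_, i) S ++ forestVerts f (suc i) (nextLayer i S)

    forestEdges : ℕ → ℕ → List (Fin n) → List (CVert n × CVert n)
    forestEdges zero    i S = []
    forestEdges (suc f) i S = layerEdges i S ++ forestEdges f (suc i) (nextLayer i S)

    forestCode : ℕ → ℕ → List (Fin n) → List Bool
    forestCode zero    i S = []
    forestCode (suc f) i S = layerCode i S ++ forestCode f (suc i) (nextLayer i S)

    lastLayer : ℕ → ℕ → List (Fin n) → List (Fin n)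
    lastLayer zero    i S = S
    lastLayer (suc f) i S = lastLayer f (suc i) (nextLayer i S)

    module _ (length-nb≤Δ : ∀ x → length (nb x) ≤ Δ) where

      length-childCode : ∀ x i → length (childCode x i) ≡ Δ
      length-childCode x i = begin
        length (mask x i ++ replicate (Δ ∸ length (mask x i)) false)
          ≡⟨ List.length-++ (mask x i) ⟩
        length (mask x i) + length (replicate (Δ ∸ length (mask x i)) false)
          ≡⟨ cong (length (mask x i) +_) (List.length-replicate (Δ ∸ length (mask x i))) ⟩
        length (mask x i) + (Δ ∸ length (mask x i))
          ≡⟨ m+[n∸m]≡n (≤-trans (≤-reflexive (List.length-map _ (nb x))) (length-nb≤Δ x)) ⟩
        Δ ∎
        where open ≡-Reasoning

      take-childCode : ∀ x i rest → take Δ (childCode x i ++ rest) ≡ childCode x i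
      take-childCode x i rest = subst (λ k → take k (childCode x i ++ rest) ≡ childCode x i)
        (length-childCode x i) (take-length-++ (childCode x i) rest)

      drop-childCode : ∀ x i rest → drop Δ (childCode x i ++ rest) ≡ rest
      drop-childCode x i rest = subst (λ k → drop k (childCode x i ++ rest) ≡ rest)
        (length-childCode x i) (drop-length-++ (childCode x i) rest)

      decodeLayer-layerCode : ∀ i S rest →
        decodeLayer i S (layerCode i S ++ rest) ≡ (nextLayer i S , layerEdges i S , rest)
      decodeLayer-layerCode i []       rest = refl
      decodeLayer-layerCode i (x ∷ xs) rest
        rewrite List.++-assoc (childCode x i) (layerCode i xs) rest
              | take-childCode x i (layerCode i xs ++ rest)
              | drop-childCode x i (layerCode i xs ++ rest)
              | select-mask (P? (x , i)) (nb x) (replicate (Δ ∸ length (mask x i)) false)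
              | decodeLayer-layerCode i xs rest = refl

      decodeForest-forestCode : ∀ f i S rest →
        decodeForest f i S (forestCode f i S ++ rest) ≡ (forestVerts f i S , forestEdges f i S)
      decodeForest-forestCode zero    i S rest = refl
      decodeForest-forestCode (suc f) i S rest
        rewrite List.++-assoc (layerCode i S) (forestCode f (suc i) (nextLayer i S)) rest
              | decodeLayer-layerCode i S (forestCode f (suc i) (nextLayer i S) ++ rest)
              | decodeForest-forestCode f (suc i) (nextLayer i S) rest = refl

      length-layerCode : ∀ i S → length (layerCode i S) ≡ Δ * length S
      length-layerCode i []       = sym (*-zeroʳ Δ)
      length-layerCode i (x ∷ xs) = begin
        length (childCode x i ++ layerCode i xs)        ≡⟨ List.length-++ (childCode x i) ⟩
        length (childCode x i) + length (layerCode i xs) ≡⟨ cong₂ _+_ (length-childCode x i) (length-layerCode i xs) ⟩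
        Δ + Δ * length xs                               ≡⟨ *-suc Δ (length xs) ⟨
        Δ * suc (length xs)                             ∎
        where open ≡-Reasoning

      length-forestCode : ∀ f i S → length (forestCode f i S) ≡ Δ * length (forestVerts f i S)
      length-forestCode zero    i S = sym (*-zeroʳ Δ)
      length-forestCode (suc f) i S = begin
        length (layerCode i S ++ forestCode f (suc i) T)          ≡⟨ List.length-++ (layerCode i S) ⟩
        length (layerCode i S) + length (forestCode f (suc i) T)  ≡⟨ cong₂ _+_ (length-layerCode i S)
                                                                       (length-forestCode f (suc i) T) ⟩
        Δ * length S + Δ * length (forestVerts f (suc i) T)       ≡⟨ *-distribˡ-+ Δ (length S) _ ⟨
        Δ * (length S + length (forestVerts f (suc i) T))         ≡⟨ cong (λ k → Δ * (k + length (forestVerts f (suc i) T)))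
                                                                       (List.length-map (_, i) S) ⟨
        Δ * (length (map (_, i) S) + length (forestVerts f (suc i) T))
                                                                  ≡⟨ cong (Δ *_) (List.length-++ (map (_, i) S)) ⟨
        Δ * length (forestVerts (suc f) i S)                      ∎
        where
        open ≡-Reasoning
        T = nextLayer i S

    trues-childCode : ∀ x i → trues (childCode x i) ≡ length (children x i)
    trues-childCode x i = begin
      trues (mask x i ++ replicate (Δ ∸ length (mask x i)) false)
        ≡⟨ trues-++ (mask x i) _ ⟩
      trues (mask x i) + trues (replicate (Δ ∸ length (mask x i)) false)
        ≡⟨ cong₂ _+_ (trues-mask (P? (x , i)) (nb x)) (trues-replicate-false (Δ ∸ length (mask x i))) ⟩
      length (children x i) + 0
        ≡⟨ +-identityʳ _ ⟩
      length (children x i) ∎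
      where open ≡-Reasoning

    trues-layerCode : ∀ i S → trues (layerCode i S) ≡ length (layerEdges i S)
    trues-layerCode i []       = refl
    trues-layerCode i (x ∷ xs) = begin
      trues (childCode x i ++ layerCode i xs)            ≡⟨ trues-++ (childCode x i) (layerCode i xs) ⟩
      trues (childCode x i) + trues (layerCode i xs)     ≡⟨ cong₂ _+_ (trues-childCode x i) (trues-layerCode i xs) ⟩
      length (children x i) + length (layerEdges i xs)   ≡⟨ cong (_+ _) (List.length-map (edge x i) (children x i)) ⟨
      length (map (edge x i) (children x i)) + length (layerEdges i xs)
                                                         ≡⟨ List.length-++ (map (edge x i) (children x i)) ⟨
      length (layerEdges i (x ∷ xs))                     ∎
      where open ≡-Reasoning

    trues-forestCode : ∀ f i S → trues (forestCode f i S) ≡ length (forestEdges f i S)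
    trues-forestCode zero    i S = refl
    trues-forestCode (suc f) i S = begin
      trues (layerCode i S ++ forestCode f (suc i) T)              ≡⟨ trues-++ (layerCode i S) _ ⟩
      trues (layerCode i S) + trues (forestCode f (suc i) T)       ≡⟨ cong₂ _+_ (trues-layerCode i S)
                                                                         (trues-forestCode f (suc i) T) ⟩
      length (layerEdges i S) + length (forestEdges f (suc i) T)   ≡⟨ List.length-++ (layerEdges i S) ⟨
      length (forestEdges (suc f) i S)                             ∎
      where
      open ≡-Reasoning
      T = nextLayer i S

    length-layerEdges : ∀ i S → length (layerEdges i S) ≡ length (nextLayer i S)
    length-layerEdges i []       = refl
    length-layerEdges i (x ∷ xs) = begin
      length (map (edge x i) (children x i) ++ layerEdges i xs)
        ≡⟨ List.length-++ (map (edge x i) (children x i)) ⟩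
      length (map (edge x i) (children x i)) + length (layerEdges i xs)
        ≡⟨ cong₂ _+_ (List.length-map (edge x i) (children x i)) (length-layerEdges i xs) ⟩
      length (children x i) + length (nextLayer i xs)
        ≡⟨ List.length-++ (children x i) ⟨
      length (nextLayer i (x ∷ xs)) ∎
      where open ≡-Reasoning

    -- Every vertex but the roots S (and the unexplored last layer) is the target of exactly one edge.
    length-forestEdges : ∀ f i S →
      length (forestEdges f i S) + length S ≡ length (forestVerts f i S) + length (lastLayer f i S)
    length-forestEdges zero    i S = refl
    length-forestEdges (suc f) i S = begin
      length (layerEdges i S ++ E′) + length S         ≡⟨ cong (_+ length S) (List.length-++ (layerEdges i S)) ⟩
      length (layerEdges i S) + length E′ + length S   ≡⟨ cong (λ k → k + length E′ + length S) (length-layerEdges i S) ⟩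
      length T + length E′ + length S                  ≡⟨ cong (_+ length S) (+-comm (length T) (length E′)) ⟩
      length E′ + length T + length S                  ≡⟨ cong (_+ length S) (length-forestEdges f (suc i) T) ⟩
      length V′ + length L + length S                  ≡⟨ +-comm (length V′ + length L) (length S) ⟩
      length S + (length V′ + length L)                ≡⟨ +-assoc (length S) (length V′) (length L) ⟨
      length S + length V′ + length L                  ≡⟨ cong (λ k → k + length V′ + length L) (List.length-map (_, i) S) ⟨
      length (map (_, i) S) + length V′ + length L     ≡⟨ cong (_+ length L) (List.length-++ (map (_, i) S)) ⟨
      length (map (_, i) S ++ V′) + length L           ∎
      where
      open ≡-Reasoning
      T  = nextLayer i S
      E′ = forestEdges f (suc i) T
      V′ = forestVerts f (suc i) T
      L  = lastLayer f (suc i) T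

_≟ᶜ_ : ∀ {n} → DecidableEquality (CVert n)
_≟ᶜ_ = Product.≡-dec FinP._≟_ _≟_

module GroundedForest {b n : ℕ} (L : Landscape b n) (grounded : Grounded L) where

  data Descendant (v : CVert n) : CVert n → Set where
    here  : Descendant v v
    child : ∀ {a c} → Descendant v a → (a , c) ∈ edges L → Descendant v c

  level-edge : ∀ {a c} → (a , c) ∈ edges L → level c ≡ suc (level a)
  level-edge e = proj₂ (edges-canvas L e)

  level-Descendant : ∀ {v w} → Descendant v w → level v ≤ level w
  level-Descendant here        = ≤-refl
  level-Descendant (child d e) = ≤-trans (level-Descendant d) (≤-trans (n≤1+n _) (≤-reflexive (sym (level-edge e))))

  -- Without an incoming edge at v, the component of v consists of descendants of v: since in-degrees
  -- are at most 1, walking an edge backwards only retraces the path. So it has no vertex of level 0.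
  parent : ∀ {v} → v ∈ verts L → ∀ {i} → level v ≡ suc i → ∃ λ u → (u , v) ∈ edges L
  parent {v} v∈ {i} lv with Any.any? (λ e → proj₂ e ≟ᶜ v) (edges L)
  ... | yes hasIn with (u , w) , e , refl ← find hasIn = u , e
  ... | no  noIn  with u , path , lu ← grounded v∈ =
    ⊥-elim (1+n≰0 (subst₂ _≤_ lv lu (level-Descendant (walk here path))))
    where
    1+n≰0 : ¬ (suc i ≤ 0)
    1+n≰0 ()
    step : ∀ {a c} → Descendant v a → Adj L a c → Descendant v c
    step d            (inj₁ e) = child d e
    step here         (inj₂ e) = ⊥-elim (noIn (lose e refl))
    step (child d e′) (inj₂ e) = subst (Descendant v) (indeg≤1 L e′ e) d
    walk : ∀ {a c} → Descendant v a → Star (Adj L) a c → Descendant v c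
    walk d ε        = d
    walk d (s ◅ ss) = walk (step d s) ss

  ancestors : ∀ i {v} → v ∈ verts L → level v ≡ i → Σ (List (CVert n)) λ cs →
    length cs ≡ suc i × Unique cs × All (_∈ verts L) cs × All (λ c → level c ≤ i) cs
  ancestors zero    v∈ lv = [ _ ] , refl , [] ∷ [] , v∈ ∷ [] , ≤-reflexive lv ∷ []
  ancestors (suc i) {v} v∈ lv
    with u , e ← parent v∈ lv
    with cs , length-cs , !cs , cs⊆ , cs≤i ← ancestors i (edges-src L e) (suc-injective (trans (sym (level-edge e)) lv))
    = v ∷ cs , cong suc length-cs , All.map v∉ cs≤i ∷ !cs , v∈ ∷ cs⊆ , ≤-reflexive lv ∷ All.map (λ c≤i → m≤n⇒m≤1+n c≤i) cs≤i
    where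
    v∉ : ∀ {c} → level c ≤ i → v ≢ c
    v∉ c≤i refl = 1+n≰n (subst (_≤ i) lv c≤i)

  level<length-verts : ∀ {v} → v ∈ verts L → level v < length (verts L)
  level<length-verts {v} v∈ with cs , length-cs , !cs , cs⊆ , _ ← ancestors (level v) v∈ refl =
    subst (_≤ length (verts L)) length-cs (Unique-⊆⇒length≤ !cs (All.lookup cs⊆))

module ForestTraversal {b n : ℕ} (L : Landscape b n) (grounded : Grounded L)
  (nb : Fin n → List (Fin n)) (Unique-nb : ∀ x → Unique (nb x))
  (nb-complete : ∀ {x i y} → edge x i y ∈ edges L → y ∈ nb x) (Δ : ℕ) where

  open GroundedForest L grounded

  ChildEdge : CVert n → Fin n → Set
  ChildEdge v y = (v , (y , suc (level v))) ∈ edges L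

  childEdge? : ∀ v y → Dec (ChildEdge v y)
  childEdge? v y = Any.any? (λ e → (v , (y , suc (level v))) ≟ₑ e) (edges L)
    where _≟ₑ_ = Product.≡-dec _≟ᶜ_ _≟ᶜ_

  open ForestCode nb Δ public
  open Encode ChildEdge childEdge? public

  ∈nextLayer⁻ : ∀ i S {y} → y ∈ nextLayer i S → ∃ λ x → x ∈ S × edge x i y ∈ edges L
  ∈nextLayer⁻ i (x ∷ xs) y∈ with ∈-++⁻ (children x i) y∈
  ... | inj₁ y∈ch = x , here refl , proj₂ (∈-filter⁻ (childEdge? (x , i)) {xs = nb x} y∈ch)
  ... | inj₂ y∈xs with x′ , x′∈ , e ← ∈nextLayer⁻ i xs y∈xs = x′ , there x′∈ , e

  ∈nextLayer⁺ : ∀ i S {x y} → x ∈ S → edge x i y ∈ edges L → y ∈ nextLayer i S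
  ∈nextLayer⁺ i (x ∷ xs) (here refl) e = ∈-++⁺ˡ (∈-filter⁺ (childEdge? (x , i)) (nb-complete e) e)
  ∈nextLayer⁺ i (x ∷ xs) (there x∈)  e = ∈-++⁺ʳ (children x i) (∈nextLayer⁺ i xs x∈ e)

  layerEdges⊆edges : ∀ i S {e} → e ∈ layerEdges i S → e ∈ edges L
  layerEdges⊆edges i (x ∷ xs) e∈ with ∈-++⁻ (map (edge x i) (children x i)) e∈
  ... | inj₂ e∈xs = layerEdges⊆edges i xs e∈xs
  ... | inj₁ e∈ch with y , y∈ , refl ← ∈-map⁻ (edge x i) e∈ch =
    proj₂ (∈-filter⁻ (childEdge? (x , i)) {xs = nb x} y∈)

  ∈layerEdges⁺ : ∀ i S {x y} → x ∈ S → edge x i y ∈ edges L → edge x i y ∈ layerEdges i S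
  ∈layerEdges⁺ i (x ∷ xs) (here refl) e =
    ∈-++⁺ˡ (∈-map⁺ (edge x i) (∈-filter⁺ (childEdge? (x , i)) (nb-complete e) e))
  ∈layerEdges⁺ i (x ∷ xs) (there x∈) e = ∈-++⁺ʳ (map (edge x i) (children x i)) (∈layerEdges⁺ i xs x∈ e)

  -- distinct parents have disjoint sets of children, as in-degrees are at most 1
  Unique-nextLayer : ∀ i S → Unique S → Unique (nextLayer i S)
  Unique-nextLayer i []       _          = []
  Unique-nextLayer i (x ∷ xs) (x∉ ∷ !xs) =
    Unique.++⁺ (Unique.filter⁺ (childEdge? (x , i)) (Unique-nb x)) (Unique-nextLayer i xs !xs) disjoint
    where
    disjoint : ∀ {y} → ¬ (y ∈ children x i × y ∈ nextLayer i xs)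
    disjoint (y∈ch , y∈xs) with x′ , x′∈ , e′ ← ∈nextLayer⁻ i xs y∈xs =
      All.lookup x∉ x′∈ (cong proj₁ (indeg≤1 L (proj₂ (∈-filter⁻ (childEdge? (x , i)) {xs = nb x} y∈ch)) e′))

  IsLayer : ℕ → List (Fin n) → Set
  IsLayer i S = Unique S × (∀ {x} → x ∈ S → (x , i) ∈ verts L) × (∀ {x} → (x , i) ∈ verts L → x ∈ S)

  IsLayer-nextLayer : ∀ i S → IsLayer i S → IsLayer (suc i) (nextLayer i S)
  IsLayer-nextLayer i S (!S , S⊆ , S⊇) = Unique-nextLayer i S !S , sound , complete
    where
    sound : ∀ {y} → y ∈ nextLayer i S → (y , suc i) ∈ verts L
    sound y∈ with _ , _ , e ← ∈nextLayer⁻ i S y∈ = edges-tgt L e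
    complete : ∀ {y} → (y , suc i) ∈ verts L → y ∈ nextLayer i S
    complete y∈ with (x , j) , e ← parent y∈ {i} refl with refl ← suc-injective (level-edge e) =
      ∈nextLayer⁺ i S (S⊇ (edges-src L e)) e

  record Traversal (f i : ℕ) (S : List (Fin n)) : Set where
    field
      verts-sound    : ∀ {v} → v ∈ forestVerts f i S → v ∈ verts L × i ≤ level v
      verts-complete : ∀ {v} → v ∈ verts L → i ≤ level v → v ∈ forestVerts f i S
      edges-sound    : ∀ {e} → e ∈ forestEdges f i S → e ∈ edges L
      edges-complete : ∀ {e} → e ∈ edges L → i ≤ level (proj₁ e) → e ∈ forestEdges f i S
      Unique-verts   : Unique (forestVerts f i S)
      lastLayer-[]   : lastLayer f i S ≡ []

  traversal-done : ∀ i S → IsLayer i S → (∀ {v} → v ∈ verts L → level v < i) → Traversal zero i S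
  traversal-done i S (_ , S⊆ , _) below = record
    { verts-sound    = λ ()
    ; verts-complete = λ v∈ i≤ → ⊥-elim (<⇒≱ (below v∈) i≤)
    ; edges-sound    = λ ()
    ; edges-complete = λ e∈ i≤ → ⊥-elim (<⇒≱ (below (edges-src L e∈)) i≤)
    ; Unique-verts   = []
    ; lastLayer-[]   = empty S S⊆
    }
    where
    empty : ∀ S′ → (∀ {x} → x ∈ S′ → (x , i) ∈ verts L) → S′ ≡ []
    empty []      _   = refl
    empty (x ∷ _) S′⊆ = ⊥-elim (<-irrefl refl (below (S′⊆ (here refl))))

  traversal-step : ∀ f i S → IsLayer i S → Traversal f (suc i) (nextLayer i S) → Traversal (suc f) i S
  traversal-step f i S (!S , S⊆ , S⊇) rest = record
    { verts-sound    = verts-sound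
    ; verts-complete = verts-complete
    ; edges-sound    = edges-sound
    ; edges-complete = edges-complete
    ; Unique-verts   = Unique.++⁺ (Unique.map⁺ (cong proj₁) !S) (Traversal.Unique-verts rest) disjoint
    ; lastLayer-[]   = Traversal.lastLayer-[] rest
    }
    where
    module R = Traversal rest
    verts-sound : ∀ {v} → v ∈ forestVerts (suc f) i S → v ∈ verts L × i ≤ level v
    verts-sound v∈ with ∈-++⁻ (map (_, i) S) v∈
    ... | inj₁ v∈S with x , x∈ , refl ← ∈-map⁻ (_, i) v∈S = S⊆ x∈ , ≤-refl
    ... | inj₂ v∈R with v∈L , i<v ← R.verts-sound v∈R = v∈L , ≤-trans (n≤1+n i) i<v
    verts-complete : ∀ {v} → v ∈ verts L → i ≤ level v → v ∈ forestVerts (suc f) i S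
    verts-complete {x , j} v∈ i≤j with m≤n⇒m<n∨m≡n i≤j
    ... | inj₁ i<j  = ∈-++⁺ʳ (map (_, i) S) (R.verts-complete v∈ i<j)
    ... | inj₂ refl = ∈-++⁺ˡ (∈-map⁺ (_, i) (S⊇ v∈))
    edges-sound : ∀ {e} → e ∈ forestEdges (suc f) i S → e ∈ edges L
    edges-sound e∈ with ∈-++⁻ (layerEdges i S) e∈
    ... | inj₁ e∈S = layerEdges⊆edges i S e∈S
    ... | inj₂ e∈R = R.edges-sound e∈R
    edges-complete : ∀ {e} → e ∈ edges L → i ≤ level (proj₁ e) → e ∈ forestEdges (suc f) i S
    edges-complete {(x , j) , _} e∈ i≤j with m≤n⇒m<n∨m≡n i≤j
    ... | inj₁ i<j = ∈-++⁺ʳ (layerEdges i S) (R.edges-complete e∈ i<j)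
    ... | inj₂ refl with refl ← level-edge e∈ = ∈-++⁺ˡ (∈layerEdges⁺ i S (S⊇ (edges-src L e∈)) e∈)
    disjoint : ∀ {v} → ¬ (v ∈ map (_, i) S × v ∈ forestVerts f (suc i) (nextLayer i S))
    disjoint (v∈S , v∈R) with x , _ , refl ← ∈-map⁻ (_, i) v∈S = 1+n≰n (proj₂ (R.verts-sound v∈R))

  traversal : ∀ f i S → IsLayer i S → (∀ {v} → v ∈ verts L → level v < i + f) → Traversal f i S
  traversal zero    i S layer below = traversal-done i S layer (λ {v} v∈ → subst (level v <_) (+-identityʳ i) (below v∈))
  traversal (suc f) i S layer below = traversal-step f i S layer
    (traversal f (suc i) (nextLayer i S) (IsLayer-nextLayer i S layer) (λ {v} v∈ → subst (level v <_) (+-suc i f) (below v∈)))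

emptyVarGraph : ∀ n → VarGraph n
emptyVarGraph n = record
  { var = λ _ → [] ; cl = λ _ → [] ; var-unique = λ _ → [] ; cl-unique = λ _ → []
  ; var⇒cl = λ _ _ () ; cl⇒var = λ _ _ () }

module _ {n : ℕ} where

  IsVarGraph : (vars cls : Vec (List (Fin n)) n) → Set
  IsVarGraph vars cls = (∀ x → Unique (lookup vars x)) × (∀ x → Unique (lookup cls x))
    × (∀ x → All (λ y → x ∈ lookup cls y) (lookup vars x)) × (∀ y → All (λ x → y ∈ lookup vars x) (lookup cls y))

  isVarGraph? : ∀ vars cls → Dec (IsVarGraph vars cls)
  isVarGraph? vars cls =
          FinP.all? (λ x → DecUnique.unique? FinP._≟_ (lookup vars x))
    ×-dec FinP.all? (λ x → DecUnique.unique? FinP._≟_ (lookup cls x))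
    ×-dec FinP.all? (λ x → All.all? (λ y → DecMembership._∈?_ FinP._≟_ x (lookup cls y)) (lookup vars x))
    ×-dec FinP.all? (λ y → All.all? (λ x → DecMembership._∈?_ FinP._≟_ y (lookup vars x)) (lookup cls y))

  varGraphOf : (vars cls : Vec (List (Fin n)) n) → VarGraph n
  varGraphOf vars cls with isVarGraph? vars cls
  ... | yes (!vars , !cls , vars⇒cls , cls⇒vars) = record
    { var = lookup vars ; cl = lookup cls ; var-unique = !vars ; cl-unique = !cls
    ; var⇒cl = λ x y y∈ → All.lookup (vars⇒cls x) y∈ ; cl⇒var = λ x y x∈ → All.lookup (cls⇒vars y) x∈ }
  ... | no  _ = emptyVarGraph n

  varGraphOf-tabulate : ∀ G → (∀ x → var (varGraphOf (tabulate (var G)) (tabulate (cl G))) x ≡ var G x)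
                            × (∀ x → cl (varGraphOf (tabulate (var G)) (tabulate (cl G))) x ≡ cl G x)
  varGraphOf-tabulate G with isVarGraph? (tabulate (var G)) (tabulate (cl G))
  ... | yes _ = Vec.lookup∘tabulate (var G) , Vec.lookup∘tabulate (cl G)
  ... | no ¬G = ⊥-elim (¬G (!vars , !cls , vars⇒cls , cls⇒vars))
    where
    vars≡ = Vec.lookup∘tabulate (var G)
    cls≡  = Vec.lookup∘tabulate (cl G)
    !vars : ∀ x → Unique (lookup (tabulate (var G)) x)
    !vars x = subst Unique (sym (vars≡ x)) (var-unique G x)
    !cls : ∀ x → Unique (lookup (tabulate (cl G)) x)
    !cls x = subst Unique (sym (cls≡ x)) (cl-unique G x)
    vars⇒cls : ∀ x → All (λ y → x ∈ lookup (tabulate (cl G)) y) (lookup (tabulate (var G)) x)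
    vars⇒cls x = subst (All _) (sym (vars≡ x)) (All.tabulate λ {y} y∈ → subst (x ∈_) (sym (cls≡ y)) (var⇒cl G x y y∈))
    cls⇒vars : ∀ y → All (λ x → y ∈ lookup (tabulate (var G)) x) (lookup (tabulate (cl G)) y)
    cls⇒vars y = subst (All _) (sym (cls≡ y)) (All.tabulate λ {x} x∈ → subst (y ∈_) (sym (vars≡ x)) (cl⇒var G x y x∈))

varGraphs : (n D : ℕ) → List (VarGraph n)
varGraphs n D = map (λ (vars , cls) → varGraphOf vars cls)
  (cartesianProduct (vectors (listsUpTo (allFin n) D) n) (vectors (listsUpTo (allFin n) n) n))

∈-varGraphs : ∀ {n D} (G : VarGraph n) → (∀ x → length (var G x) ≤ D) → ∃ λ G′ →
  G′ ∈ varGraphs n D × (∀ x → var G′ x ≡ var G x) × (∀ x → cl G′ x ≡ cl G x)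
∈-varGraphs {n} G var≤D = varGraphOf (tabulate (var G)) (tabulate (cl G)) ,
  ∈-map⁺ (λ (vars , cls) → varGraphOf vars cls)
    (∈-cartesianProduct⁺ (tabulate∈vectors (var G) (λ x → ∈-listsUpTo _ allFin⊇ (var≤D x)))
                         (tabulate∈vectors (cl G) (λ x → ∈-listsUpTo _ allFin⊇ (length-cl≤n x)))) ,
  varGraphOf-tabulate G
  where
  allFin⊇ : ∀ {xs} → All (_∈ allFin n) xs
  allFin⊇ = All.tabulate (λ {x} _ → ∈-allFin x)
  length-cl≤n : ∀ x → length (cl G x) ≤ n
  length-cl≤n x = ≤-trans (Unique-⊆⇒length≤ (cl-unique G x) (λ {z} _ → ∈-allFin z)) (≤-reflexive (List.length-tabulate (λ i → i)))

RelEdge-cong : ∀ {n} {G G′ : VarGraph n} → (∀ x → var G′ x ≡ var G x) → ∀ {x y} → RelEdge G x y → RelEdge G′ x y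
RelEdge-cong {G = G} {G′} var≡ {x} {y} r =
  subst (Any (_∈ var G′ y)) (sym (var≡ x)) (Any.map (λ {z} z∈ → subst (z ∈_) (sym (var≡ y)) z∈) r)

module Realise (b : ℕ) where

  _≟ᵃ_ : DecidableEquality (List (Fin b))
  _≟ᵃ_ = List.≡-dec FinP._≟_

  record Raw (n : ℕ) : Set where
    field
      rawGraph : VarGraph n
      rawRc    : Fin n → List (List (Fin b))
      rawVerts : List (CVert n)
      rawEdges : List (CVert n × CVert n)
      rawFinal : Fin n → Fin b
      rawPrev  : CVert n → List (Fin b)
      rawπ     : Fin n → ℕ
  open Raw

  -- the conditions of Landscape and Decoration, with the quantifiers over lists made explicit
  Valid : ∀ {n} → Raw n → Set
  Valid r =
      (∀ x → All (λ a → length a ≡ length (var (rawGraph r) x)) (rawRc r x))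
    × (∀ x → Unique (rawRc r x))
    × Unique (rawVerts r)
    × All (λ (v , w) → v ∈ rawVerts r × w ∈ rawVerts r × CanvasEdge (rawGraph r) v w) (rawEdges r)
    × All (λ (v , w) → All (λ (v′ , w′) → w ≡ w′ → v ≡ v′) (rawEdges r)) (rawEdges r)
    × All (λ v → All (λ w → v ≢ w → level v ≡ level w → Dist≥2 (rawGraph r) (proj₁ v) (proj₁ w)) (rawVerts r)) (rawVerts r)
    × All (λ v → rawPrev r v ∈ rawRc r (proj₁ v)) (rawVerts r)

  valid? : ∀ {n} (r : Raw n) → Dec (Valid r)
  valid? r =
          FinP.all? (λ x → All.all? (λ a → length a ≟ length (var G x)) (rawRc r x))
    ×-dec FinP.all? (λ x → DecUnique.unique? _≟ᵃ_ (rawRc r x))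
    ×-dec DecUnique.unique? _≟ᶜ_ (rawVerts r)
    ×-dec All.all? (λ ((x , i) , (y , j)) → (x , i) ∈ᶜ? rawVerts r ×-dec (y , j) ∈ᶜ? rawVerts r
                                          ×-dec relEdge? G x y ×-dec j ≟ suc i) (rawEdges r)
    ×-dec All.all? (λ (v , w) → All.all? (λ (v′ , w′) → (w ≟ᶜ w′) →-dec (v ≟ᶜ v′)) (rawEdges r)) (rawEdges r)
    ×-dec All.all? (λ v → All.all? (λ w → ¬? (v ≟ᶜ w) →-dec (level v ≟ level w) →-dec
            (¬? (proj₁ v FinP.≟ proj₁ w) ×-dec ¬? (relEdge? G (proj₁ v) (proj₁ w)))) (rawVerts r)) (rawVerts r)
    ×-dec All.all? (λ v → DecMembership._∈?_ _≟ᵃ_ (rawPrev r v) (rawRc r (proj₁ v))) (rawVerts r)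
    where
    G = rawGraph r
    _∈ᶜ?_ = DecMembership._∈?_ _≟ᶜ_

  toDLand : ∀ {n} (r : Raw n) → Valid r → DLand b n
  toDLand r (rc-valid , rc-unique , verts-unique , edges-ok , indeg≤1 , separated , prev-ok) = record
    { land = record
      { graph        = rawGraph r
      ; rc           = rawRc r
      ; rc-valid     = λ x a a∈ → All.lookup (rc-valid x) a∈
      ; rc-unique    = rc-unique
      ; verts        = rawVerts r
      ; verts-unique = verts-unique
      ; edges        = rawEdges r
      ; edges-src    = λ e∈ → proj₁ (All.lookup edges-ok e∈)
      ; edges-tgt    = λ e∈ → proj₁ (proj₂ (All.lookup edges-ok e∈))
      ; edges-canvas = λ e∈ → proj₂ (proj₂ (All.lookup edges-ok e∈))
      ; indeg≤1      = λ e∈ e′∈ → All.lookup (All.lookup indeg≤1 e∈) e′∈ refl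
      ; separated    = λ v∈ w∈ → All.lookup (All.lookup separated v∈) w∈
      }
    ; deco = record
      { final   = rawFinal r
      ; prev    = rawPrev r
      ; prev-ok = All.lookup prev-ok
      ; π       = rawπ r
      }
    }

  emptyDLand : DLand b 0
  emptyDLand = toDLand emptyRaw ((λ ()) , (λ ()) , [] , [] , [] , [] , [])
    where
    emptyRaw : Raw 0
    emptyRaw = record
      { rawGraph = emptyVarGraph 0 ; rawRc = λ () ; rawVerts = [] ; rawEdges = []
      ; rawFinal = λ () ; rawPrev = λ _ → [] ; rawπ = λ () }

  -- invalid raw data is sent to a fixed junk value
  realise : ∀ n → Raw n → Σ ℕ (DLand b)
  realise n r with valid? r
  ... | yes valid = n , toDLand r valid
  ... | no  _     = 0 , emptyDLand

  realise-valid : ∀ {n} (r : Raw n) → Valid r → Σ (Valid r) λ valid → realise n r ≡ (n , toDLand r valid)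
  realise-valid r valid with valid? r
  ... | yes valid′ = valid′ , refl
  ... | no  ¬valid = ⊥-elim (¬valid valid)

  -- r lists the data of K, up to the order of the lists
  record Describes {n} (K : DLand b n) (r : Raw n) : Set where
    field
      var≡         : ∀ x → var (rawGraph r) x ≡ var (graph (land K)) x
      cl≡          : ∀ x → cl (rawGraph r) x ≡ cl (graph (land K)) x
      rc⊇          : ∀ x → rc (land K) x ⊆ rawRc r x
      rc⊆          : ∀ x → rawRc r x ⊆ rc (land K) x
      verts⊇       : verts (land K) ⊆ rawVerts r
      verts⊆       : rawVerts r ⊆ verts (land K)
      edges⊇       : edges (land K) ⊆ rawEdges r
      edges⊆       : rawEdges r ⊆ edges (land K)
      final≡       : ∀ x → rawFinal r x ≡ final (deco K) x
      prev≡        : ∀ {v} → v ∈ verts (land K) → rawPrev r v ≡ prev (deco K) v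
      π≡           : ∀ x → rawπ r x ≡ π (deco K) x
      Unique-rc    : ∀ x → Unique (rawRc r x)
      Unique-verts : Unique (rawVerts r)

  module _ {n} {K : DLand b n} {r : Raw n} (d : Describes K r) where
    open Describes d
    private
      L = land K
      G = graph L

    Describes⇒Valid : Valid r
    Describes⇒Valid =
        (λ x → All.tabulate λ a∈ → trans (rc-valid L x _ (rc⊆ x a∈)) (cong length (sym (var≡ x))))
      , Unique-rc
      , Unique-verts
      , All.tabulate (λ e∈ → let e∈L = edges⊆ e∈ in
          verts⊇ (edges-src L e∈L) , verts⊇ (edges-tgt L e∈L) ,
          RelEdge-cong {G = G} {rawGraph r} var≡ (proj₁ (edges-canvas L e∈L)) , proj₂ (edges-canvas L e∈L))
      , All.tabulate (λ e∈ → All.tabulate λ {(v′ , w′)} e′∈ w≡w′ →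
          indeg≤1 L (edges⊆ e∈) (subst (λ w → (v′ , w) ∈ edges L) (sym w≡w′) (edges⊆ e′∈)))
      , All.tabulate (λ v∈ → All.tabulate λ w∈ v≢w lv≡lw →
          let x≢y , ¬rel = separated L (verts⊆ v∈) (verts⊆ w∈) v≢w lv≡lw
          in x≢y , λ rel → ¬rel (RelEdge-cong {G = rawGraph r} {G} (λ x → sym (var≡ x)) rel))
      , All.tabulate (λ {v} v∈ → subst (_∈ rawRc r (proj₁ v)) (sym (prev≡ (verts⊆ v∈)))
          (rc⊇ (proj₁ v) (prev-ok (deco K) (verts⊆ v∈))))

    Describes⇒Iso : (valid : Valid r) → Iso K (toDLand r valid)
    Describes⇒Iso valid = record
      { φ          = ↔-id (Fin n)
      ; var-hom    = λ x → trans (var≡ x) (sym (List.map-id (var G x)))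
      ; cl-hom     = λ x → trans (cl≡ x) (sym (List.map-id (cl G x)))
      ; rule-to    = λ x a → rc⊇ x
      ; rule-from  = λ x a → rc⊆ x
      ; verts-to   = λ v → verts⊇
      ; verts-from = λ v → verts⊆
      ; edges-to   = λ e → edges⊇
      ; edges-from = λ e → edges⊆
      ; final-hom  = final≡
      ; prev-hom   = λ v → prev≡
      ; π-hom      = π≡
      }

    realise-Describes : Iso K (proj₂ (realise n r))
    realise-Describes with valid , eq ← realise-valid r Describes⇒Valid =
      subst (λ K′ → Iso K (proj₂ K′)) (sym eq) (Describes⇒Iso valid)

neighbours : ∀ {n} → VarGraph n → Fin n → List (Fin n)
neighbours {n} G x = filter (relEdge? G x) (allFin n)

module Candidates (b D Δ N₁ p : ℕ) where
  open Realise b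

  -- a variable graph, R^c, Final, π and the level-0 layer of the forest
  Base : ℕ → Set
  Base n = VarGraph n × Vec (List (List (Fin b))) n × Vec (Fin b) n × Vec ℕ n × List (Fin n)

  bases : ∀ n → List (Base n)
  bases n = cartesianProduct (varGraphs n D)
           (cartesianProduct (vectors (sublists (listsUpTo (allFin b) D)) n)
           (cartesianProduct (vectors (allFin b) n)
           (cartesianProduct (vectors (upTo p) n) (sublists (allFin n)))))

  basesUpTo : ℕ → List (Σ ℕ Base)
  basesUpTo N = concat (map (λ n → map (n ,_) (bases n)) (upTo (suc N)))

  ∈-basesUpTo : ∀ {n N} (base : Base n) → n ≤ N → base ∈ bases n → (n , base) ∈ basesUpTo N
  ∈-basesUpTo {n} base n≤N base∈ =
    ∈-concat⁺′ (∈-map⁺ (n ,_) base∈) (∈-map⁺ (λ n → map (n ,_) (bases n)) (∈-upTo⁺ (s≤s n≤N)))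

  -- The i-th number is the position of Prev of the i-th forest vertex in the list R^c of its variable.
  rawOf : ∀ {n} → Base n → List (CVert n) × List (CVert n × CVert n) → List ℕ → Raw n
  rawOf (G , rcs , finals , πs , _) (vs , es) ks = record
    { rawGraph = G
    ; rawRc    = rc′
    ; rawVerts = vs
    ; rawEdges = es
    ; rawFinal = lookup finals
    ; rawPrev  = λ v → lookupOr [] (rc′ (proj₁ v)) (valueAt _≟ᶜ_ v vs ks)
    ; rawπ     = lookup πs
    }
    where
    rc′ = λ x → deduplicate _≟ᵃ_ (lookup rcs x)

  decode : ℕ → Σ ℕ Base → List Bool → List ℕ → Σ ℕ (DLand b)
  decode N₂ (n , base@(G , _ , _ , _ , roots)) bs ks =
    realise n (rawOf base (ForestCode.decodeForest (neighbours G) Δ N₂ 0 roots bs) ks)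

  Code : Set
  Code = (Σ ℕ Base × List Bool) × List ℕ

  codes : (β N₂ : ℕ) → List Code
  codes β N₂ = cartesianProduct (cartesianProduct (basesUpTo N₁) (sparseBitStrings (Δ * N₂) N₂))
                                (listsOfLength (upTo β) N₂)

  candidates : (β N₂ : ℕ) → List (Σ ℕ (DLand b))
  candidates β N₂ = map (λ ((base , bs) , ks) → decode N₂ base bs ks) (codes β N₂)

  length-candidates : ∀ β N₂ → length (candidates β N₂) ≡
    length (basesUpTo N₁) * length (sparseBitStrings (Δ * N₂) N₂) * β ^ N₂
  length-candidates β N₂ = begin
    length (candidates β N₂)                                  ≡⟨ List.length-map _ (codes β N₂) ⟩
    length (codes β N₂)                                       ≡⟨ length-cartesianProduct (cartesianProduct B S) Ks ⟩
    length (cartesianProduct B S) * length Ks                 ≡⟨ cong₂ _*_ (length-cartesianProduct B S)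
                                                                   (length-listsOfLength (upTo β) N₂) ⟩
    length B * length S * length (upTo β) ^ N₂                ≡⟨ cong (λ k → length B * length S * k ^ N₂) (List.length-upTo β) ⟩
    length B * length S * β ^ N₂                              ∎
    where
    open ≡-Reasoning
    B  = basesUpTo N₁
    S  = sparseBitStrings (Δ * N₂) N₂
    Ks = listsOfLength (upTo β) N₂

  module Encoding (β N₂ : ℕ) {n} (K : DLand b n) (grounded : Grounded (land K))
                  (type : HasType D Δ β N₁ N₂ p K) where
    open HasType type
    private
      L = land K
      G = graph L
      V = verts L
      _∈ᵃ?_ : ∀ (a : List (Fin b)) as → Dec (a ∈ as)
      _∈ᵃ?_ = DecMembership._∈?_ _≟ᵃ_
      isRoot? : ∀ x → Dec ((x , 0) ∈ V)
      isRoot? x = DecMembership._∈?_ _≟ᶜ_ (x , 0) V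

    private
      twin = ∈-varGraphs G outdeg

    G′ : VarGraph n
    G′ = proj₁ twin

    G′∈ : G′ ∈ varGraphs n D
    G′∈ = proj₁ (proj₂ twin)

    var≡ : ∀ x → var G′ x ≡ var G x
    var≡ = proj₁ (proj₂ (proj₂ twin))

    cl≡ : ∀ x → cl G′ x ≡ cl G x
    cl≡ = proj₂ (proj₂ (proj₂ twin))

    nb = neighbours G′

    Unique-nb : ∀ x → Unique (nb x)
    Unique-nb x = Unique.filter⁺ (relEdge? G′ x) (Unique.allFin⁺ n)

    nb-complete : ∀ {x i y} → edge x i y ∈ edges L → y ∈ nb x
    nb-complete {x} {i} {y} e =
      ∈-filter⁺ (relEdge? G′ x) (∈-allFin y) (RelEdge-cong {G = G} {G′} var≡ (proj₁ (edges-canvas L e)))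

    length-nb≤Δ : ∀ x → length (nb x) ≤ Δ
    length-nb≤Δ x = ≤-trans (Unique-⊆⇒length≤ (Unique-nb x) nb⊆) (reldeg x)
      where
      nb⊆ : nb x ⊆ filter (relEdge? G x) (allFin n)
      nb⊆ y∈ with y∈all , rel ← ∈-filter⁻ (relEdge? G′ x) {xs = allFin n} y∈ =
        ∈-filter⁺ (relEdge? G x) y∈all (RelEdge-cong {G = G′} {G} (λ z → sym (var≡ z)) rel)

    roots : List (Fin n)
    roots = filter isRoot? (allFin n)

    rcFilter : Fin n → List (List (Fin b))
    rcFilter x = filter (_∈ᵃ? rc L x) (listsUpTo (allFin b) D)

    base : Base n
    base = G′ , tabulate rcFilter , tabulate (final (deco K)) , tabulate (π (deco K)) , roots

    base∈ : (n , base) ∈ basesUpTo N₁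
    base∈ = ∈-basesUpTo base size
      (∈-cartesianProduct⁺ G′∈
      (∈-cartesianProduct⁺ (tabulate∈vectors rcFilter (λ x → filter∈sublists (_∈ᵃ? rc L x) (listsUpTo (allFin b) D)))
      (∈-cartesianProduct⁺ (tabulate∈vectors (final (deco K)) (λ _ → ∈-allFin _))
      (∈-cartesianProduct⁺ (tabulate∈vectors (π (deco K)) (λ x → ∈-upTo⁺ (πbound x)))
                           (filter∈sublists isRoot? (allFin n))))))

    open ForestTraversal L grounded nb Unique-nb nb-complete Δ

    roots-layer : IsLayer 0 roots
    roots-layer = Unique.filter⁺ isRoot? (Unique.allFin⁺ n)
                , (λ x∈ → proj₂ (∈-filter⁻ isRoot? {xs = allFin n} x∈))
                , (λ {x} v∈ → ∈-filter⁺ isRoot? (∈-allFin x) v∈)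

    open Traversal (traversal N₂ 0 roots roots-layer
      (λ v∈ → subst (_ <_) nverts (GroundedForest.level<length-verts L grounded v∈)))

    vs = forestVerts N₂ 0 roots
    es = forestEdges N₂ 0 roots
    bs = forestCode N₂ 0 roots

    length-vs : length vs ≡ N₂
    length-vs = trans (≤-antisym (Unique-⊆⇒length≤ Unique-verts (λ v∈ → proj₁ (verts-sound v∈)))
                                 (Unique-⊆⇒length≤ (verts-unique L) (λ v∈ → verts-complete v∈ z≤n)))
                      nverts

    bs∈ : bs ∈ sparseBitStrings (Δ * N₂) N₂
    bs∈ = ∈-sparseBitStrings bs
      (trans (length-forestCode length-nb≤Δ N₂ 0 roots) (cong (Δ *_) length-vs))
      (begin
        trues bs                                      ≡⟨ trues-forestCode N₂ 0 roots ⟩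
        length es                                     ≤⟨ m≤m+n (length es) (length roots) ⟩
        length es + length roots                      ≡⟨ length-forestEdges N₂ 0 roots ⟩
        length vs + length (lastLayer N₂ 0 roots)     ≡⟨ cong (λ l → length vs + length l) lastLayer-[] ⟩
        length vs + 0                                 ≡⟨ +-identityʳ (length vs) ⟩
        length vs                                     ≡⟨ length-vs ⟩
        N₂                                            ∎)
      where open ≤-Reasoning

    rc′ : Fin n → List (List (Fin b))
    rc′ x = deduplicate _≟ᵃ_ (lookup (tabulate rcFilter) x)

    rc⊇ : ∀ x → rc L x ⊆ rc′ x
    rc⊇ x {a} a∈ = ∈-deduplicate⁺ _≟ᵃ_ (subst (a ∈_) (sym (Vec.lookup∘tabulate rcFilter x))
      (∈-filter⁺ (_∈ᵃ? rc L x) (∈-listsUpTo a (All.tabulate λ _ → ∈-allFin _)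
                                  (≤-trans (≤-reflexive (rc-valid L x a a∈)) (outdeg x))) a∈))

    rc⊆ : ∀ x → rc′ x ⊆ rc L x
    rc⊆ x {a} a∈ = proj₂ (∈-filter⁻ (_∈ᵃ? rc L x) {xs = listsUpTo (allFin b) D}
      (subst (a ∈_) (Vec.lookup∘tabulate rcFilter x) (∈-deduplicate⁻ _≟ᵃ_ (lookup (tabulate rcFilter) x) a∈)))

    prevIndex : CVert n → ℕ
    prevIndex v = indexOf _≟ᵃ_ (prev (deco K) v) (rc′ (proj₁ v))

    prev∈ : ∀ {v} → v ∈ V → prev (deco K) v ∈ rc′ (proj₁ v)
    prev∈ {v} v∈ = rc⊇ (proj₁ v) (prev-ok (deco K) v∈)

    ks = map prevIndex vs

    ks∈ : ks ∈ listsOfLength (upTo β) N₂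
    ks∈ = ∈-listsOfLength ks (All.map⁺ (All.tabulate λ v∈ → ∈-upTo⁺ (prevIndex<β (proj₁ (verts-sound v∈)))))
                             (trans (List.length-map prevIndex vs) length-vs)
      where
      prevIndex<β : ∀ {v} → v ∈ V → prevIndex v < β
      prevIndex<β {v} v∈ = ≤-trans (indexOf< _≟ᵃ_ (rc′ (proj₁ v)) (prev∈ v∈))
        (≤-trans (Unique-⊆⇒length≤ (DecUnique.deduplicate-! _≟ᵃ_ _) (rc⊆ (proj₁ v))) (rcsize (proj₁ v)))

    code∈ : (((n , base) , bs) , ks) ∈ codes β N₂
    code∈ = ∈-cartesianProduct⁺ (∈-cartesianProduct⁺ base∈ bs∈) ks∈

    raw : Raw n
    raw = rawOf base (vs , es) ks

    describes : Describes K raw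
    describes = record
      { var≡         = var≡
      ; cl≡          = cl≡
      ; rc⊇          = rc⊇
      ; rc⊆          = rc⊆
      ; verts⊇       = λ v∈ → verts-complete v∈ z≤n
      ; verts⊆       = λ v∈ → proj₁ (verts-sound v∈)
      ; edges⊇       = λ e∈ → edges-complete e∈ z≤n
      ; edges⊆       = edges-sound
      ; final≡       = Vec.lookup∘tabulate (final (deco K))
      ; prev≡        = λ {v} v∈ → trans (cong (lookupOr [] (rc′ (proj₁ v))) (valueAt-map _≟ᶜ_ vs prevIndex (verts-complete v∈ z≤n)))
                                        (lookupOr-indexOf _≟ᵃ_ [] (rc′ (proj₁ v)) (prev∈ v∈))
      ; π≡           = Vec.lookup∘tabulate (π (deco K))
      ; Unique-rc    = λ x → DecUnique.deduplicate-! _≟ᵃ_ (lookup (tabulate rcFilter) x)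
      ; Unique-verts = Unique-verts
      }

    decode-code : decode N₂ (n , base) bs ks ≡ realise n raw
    decode-code = cong (λ forest → realise n (rawOf base forest ks)) (begin
      decodeForest N₂ 0 roots bs         ≡⟨ cong (decodeForest N₂ 0 roots) (List.++-identityʳ bs) ⟨
      decodeForest N₂ 0 roots (bs ++ [])  ≡⟨ decodeForest-forestCode length-nb≤Δ N₂ 0 roots [] ⟩
      vs , es                            ∎)
      where open ≡-Reasoning

    represented : Any (λ K′ → Iso K (proj₂ K′)) (candidates β N₂)
    represented = lose (∈-map⁺ (λ ((base , bs) , ks) → decode N₂ base bs ks) code∈)
                       (subst (λ K′ → Iso K (proj₂ K′)) (sym decode-code) (realise-Describes describes))

^-distribʳ-* : ∀ m n k → (m * n) ^ k ≡ m ^ k * n ^ k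
^-distribʳ-* m n zero    = refl
^-distribʳ-* m n (suc k) = trans (cong (m * n *_) (^-distribʳ-* m n k)) (interchange m n (m ^ k) (n ^ k))

module _ (b D k N₁ p : ℕ) where
  private
    Δ = suc (suc k)
  open Candidates b D Δ N₁ p

  length-candidates-bound : ∀ β N₂ → 1 ≤ N₂ →
    length (candidates β N₂) * suc k ^ (suc k * N₂) ≤ length (basesUpTo N₁) * N₂ ^ N₁ * (Δ ^ Δ * β) ^ N₂
  length-candidates-bound β N₂ 1≤N₂ = begin
    length (candidates β N₂) * A      ≡⟨ cong (_* A) (length-candidates β N₂) ⟩
    C * S * β ^ N₂ * A                ≡⟨ cong (_* A) (*-assoc C S (β ^ N₂)) ⟩
    C * (S * β ^ N₂) * A              ≡⟨ cong (λ t → C * t * A) (*-comm S (β ^ N₂)) ⟩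
    C * (β ^ N₂ * S) * A              ≡⟨ *-assoc C (β ^ N₂ * S) A ⟩
    C * (β ^ N₂ * S * A)              ≡⟨ cong (C *_) (*-assoc (β ^ N₂) S A) ⟩
    C * (β ^ N₂ * (S * A))            ≤⟨ *-monoʳ-≤ C (*-monoʳ-≤ (β ^ N₂) S*A≤) ⟩
    C * (β ^ N₂ * Δ ^ (Δ * N₂))       ≡⟨ cong (λ t → C * (β ^ N₂ * t)) (^-*-assoc Δ Δ N₂) ⟨
    C * (β ^ N₂ * (Δ ^ Δ) ^ N₂)       ≡⟨ cong (C *_) (*-comm (β ^ N₂) _) ⟩
    C * ((Δ ^ Δ) ^ N₂ * β ^ N₂)       ≡⟨ cong (C *_) (^-distribʳ-* (Δ ^ Δ) β N₂) ⟨
    C * (Δ ^ Δ * β) ^ N₂              ≡⟨ cong (_* (Δ ^ Δ * β) ^ N₂) (*-identityʳ C) ⟨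
    C * 1 * (Δ ^ Δ * β) ^ N₂          ≤⟨ *-monoˡ-≤ ((Δ ^ Δ * β) ^ N₂) (*-monoʳ-≤ C (m^n>0 N₂ {{>-nonZero 1≤N₂}} N₁)) ⟩
    C * N₂ ^ N₁ * (Δ ^ Δ * β) ^ N₂    ∎
    where
    open ≤-Reasoning
    C = length (basesUpTo N₁)
    S = length (sparseBitStrings (Δ * N₂) N₂)
    A = suc k ^ (suc k * N₂)
    S*A≤ : S * A ≤ Δ ^ (Δ * N₂)
    S*A≤ = subst (λ e → S * suc k ^ e ≤ Δ ^ (Δ * N₂))
      (trans (cong (Δ * N₂ ∸_) (sym (*-identityˡ N₂))) (sym (*-distribʳ-∸ N₂ Δ 1)))
      (length-sparseBitStrings* k (Δ * N₂) N₂)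

lemma3p5 : (b : ℕ) → 1 < b → (D Δ N₁ p : ℕ) → 2 ≤ Δ →
    ∃ λ (C : ℕ) → (β N₂ : ℕ) → 1 ≤ N₂ →
      ∃ λ (reps : List (Σ ℕ (DLand b))) →
        (length reps * (Δ ∸ 1) ^ ((Δ ∸ 1) * N₂) ≤ C * N₂ ^ N₁ * (Δ ^ Δ * β) ^ N₂)
        × ((n : ℕ) (K : DLand b n) → Grounded (land K) → HasType D Δ β N₁ N₂ p K →
             Any (λ r → Iso K (proj₂ r)) reps)
lemma3p5 b _ D (suc (suc k)) N₁ p (s≤s (s≤s z≤n)) =
  length (basesUpTo N₁) , λ β N₂ 1≤N₂ →
    candidates β N₂ ,
    length-candidates-bound b D k N₁ p β N₂ 1≤N₂ ,
    λ n K grounded type → Encoding.represented β N₂ K grounded type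
  where open Candidates b D (suc (suc k)) N₁ p
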